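{- For any circle graph $G$ that is not a clique, $\psi(G) \le \kappa(G)$.
   Context: A circle graph is the intersection graph of a finite set of chords of a circle. For $k \ge 3$, a $k$-polygon graph is the intersection graph of a finite set of chords of a convex $k$-sided polygon in which each chord has its endpoints on two distinct sides; $2$-polygon graphs are the permutation graphs (intersection graphs of straight line segments joining two parallel lines). Every circle graph is a $k$-polygon graph for some $k\ge 2$. The polygon number $\psi(G)$ of a circle graph $G$ is the minimum $k \ge 2$ such that $G$ is a $k$-polygon graph. $\kappa(G)$ is the minimum number of cliques needed to partition the vertex set of $G$. -}

module Defs where

open import Data.Nat using (ℕ; _≤_; _<_)
open import Data.Fin using (Fin)
open import Data.Product using (Σ; _×_; _,_; ∃)
open import Data.Sum using (_⊎_)
open import Relation.Binary.PropositionalEquality using (_≡_; _≢_)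
open import Relation.Nullary using (¬_)

record Graph (n : ℕ) : Set₁ where
  field
    Adj       : Fin n → Fin n → Set
    symmetric : ∀ {u v} → Adj u v → Adj v u
    irreflex  : ∀ {u} → ¬ Adj u u
open Graph public

IsClique : ∀ {n} → Graph n → Set
IsClique {n} G = ∀ (u v : Fin n) → u ≢ v → Adj G u v

-- Chord models (combinatorial: chords in a convex region intersect iff
-- their endpoints interleave along the boundary; all endpoints distinct).

-- Interleaving of two chords with endpoints x₁ < x₂ and y₁ < y₂ in a
-- strict linear order _≺_ (boundary read from a fixed cut point).
Interleave : {P : Set} → (P → P → Set) → P → P → P → P → Set
Interleave _≺_ x₁ x₂ y₁ y₂ =
  (x₁ ≺ y₁ × y₁ ≺ x₂ × x₂ ≺ y₂) ⊎ (y₁ ≺ x₁ × x₁ ≺ y₂ × y₂ ≺ x₂)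

-- Circle graphs: each vertex is a chord of a circle, given by two
-- positions a v < b v on the circle (cut open at a point); all 2n
-- endpoints pairwise distinct; u ~ v iff the chords cross.
record CircleModel {n : ℕ} (G : Graph n) : Set where
  field
    endpt    : Fin n → Fin 2 → ℕ
    ordered  : ∀ v → endpt v Data.Fin.zero < endpt v (Data.Fin.suc Data.Fin.zero)
    distinct : ∀ u i v j → endpt u i ≡ endpt v j → (u ≡ v × i ≡ j)
    adj⇔     : ∀ u v → u ≢ v →
               (Adj G u v → Interleave _<_ (endpt u Data.Fin.zero) (endpt u (Data.Fin.suc Data.Fin.zero))
                                         (endpt v Data.Fin.zero) (endpt v (Data.Fin.suc Data.Fin.zero)))
             × (Interleave _<_ (endpt u Data.Fin.zero) (endpt u (Data.Fin.suc Data.Fin.zero))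
                                (endpt v Data.Fin.zero) (endpt v (Data.Fin.suc Data.Fin.zero)) → Adj G u v)

IsCircleGraph : ∀ {n} → Graph n → Set
IsCircleGraph G = CircleModel G

-- Points on the boundary of a convex k-gon: (side, position along side),
-- sides numbered in cyclic order, ordered lexicographically along the
-- boundary starting at a corner.
BPt : ℕ → Set
BPt k = Fin k × ℕ

data _≺_ {k : ℕ} : BPt k → BPt k → Set where
  side< : ∀ {s t p q} → Data.Fin._<_ s t → (s , p) ≺ (t , q)
  same< : ∀ {s p q} → p < q → (s , p) ≺ (s , q)

side : ∀ {k} → BPt k → Fin k
side (s , _) = s

-- For k = 2 this is exactly a permutation-graph model.
record PolygonModel (k : ℕ) {n : ℕ} (G : Graph n) : Set where
  field
    endpt     : Fin n → Fin 2 → BPt k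
    ordered   : ∀ v → endpt v Data.Fin.zero ≺ endpt v (Data.Fin.suc Data.Fin.zero)
    diffSides : ∀ v → side (endpt v Data.Fin.zero) ≢ side (endpt v (Data.Fin.suc Data.Fin.zero))
    distinct  : ∀ u i v j → endpt u i ≡ endpt v j → (u ≡ v × i ≡ j)
    adj⇔      : ∀ u v → u ≢ v →
               (Adj G u v → Interleave _≺_ (endpt u Data.Fin.zero) (endpt u (Data.Fin.suc Data.Fin.zero))
                                         (endpt v Data.Fin.zero) (endpt v (Data.Fin.suc Data.Fin.zero)))
             × (Interleave _≺_ (endpt u Data.Fin.zero) (endpt u (Data.Fin.suc Data.Fin.zero))
                                (endpt v Data.Fin.zero) (endpt v (Data.Fin.suc Data.Fin.zero)) → Adj G u v)

IsPolygonGraph : ℕ → ∀ {n} → Graph n → Set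
IsPolygonGraph k G = PolygonModel k G

IsPolygonNumber : ∀ {n} → Graph n → ℕ → Set
IsPolygonNumber G p =
  2 ≤ p × IsPolygonGraph p G × (∀ k → 2 ≤ k → IsPolygonGraph k G → p ≤ k)

CliquePartition : ∀ {n} → Graph n → ℕ → Set
CliquePartition {n} G c =
  Σ (Fin n → Fin c) λ f → ∀ u v → f u ≡ f v → u ≢ v → Adj G u v

IsCliqueCoverNumber : ∀ {n} → Graph n → ℕ → Set
IsCliqueCoverNumber G c =
  CliquePartition G c × (∀ d → CliquePartition G d → c ≤ d)

-- Let the cliques be C₀, …, C_{k+1}.  Cutting the circle at two points t and s so that every
-- chord of C₀ and of C₁ has exactly one end on the arc [t, s) is possible by a discrete
-- intermediate value argument: slide an arc holding half of the ends of C₀ ∪ C₁ along the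
-- circle; the number of ends of C₀ on it changes by at most one per step, and it takes
-- values on both sides of |C₀| at the two antipodal positions.  For a single clique of
-- pairwise crossing chords such an arc exists because a chord with both ends on the arc
-- forces every chord crossing it to have an end there.  Reading the circle from t, the point
-- s separates the ends of every chord of C₀ ∪ C₁, and each further clique Cⱼ has its own
-- separating point (just after its last left end).  Cutting the line at these k + 1 points
-- gives the k + 2 sides of a polygon model.

module Submission where

open import Data.Empty using (⊥-elim)
open import Data.Fin using (Fin; zero; suc; toℕ; fromℕ<) renaming (_≟_ to _≟ᶠ_)
open import Data.Fin.Patterns using (0F; 1F)
import Data.Fin.Properties as Fin
open import Data.Nat
open import Data.Nat.Properties
open import Data.Product
open import Data.Sum using (_⊎_; inj₁; inj₂; [_,_]′)
open import Function using (_∘_; _⇔_; mk⇔; Equivalence)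
open import Function.Properties.Equivalence using (⇔-setoid)
import Function.Properties.Equivalence as ⇔
open import Level using (0ℓ)
open import Relation.Binary.Definitions using (tri<; tri≈; tri>)
open import Relation.Binary.PropositionalEquality
import Relation.Binary.Reasoning.Setoid (⇔-setoid 0ℓ) as ⇔-Reasoning
open import Relation.Nullary
open import Relation.Unary using (Pred; Decidable)

open import Algebra.Properties.CommutativeMonoid.Sum +-0-commutativeMonoid
  using (sum; sum-cong-≗; ∑-distrib-+)
open import Algebra.Properties.CommutativeSemigroup +-commutativeSemigroup
  using (interchange; x∙yz≈y∙xz)

open import Defs

open Equivalence using (to; from)

𝟙 : ∀ {a} {A : Set a} → Dec A → ℕ
𝟙 (yes _) = 1
𝟙 (no _)  = 0

𝟙≤1 : ∀ {a} {A : Set a} (d : Dec A) → 𝟙 d ≤ 1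
𝟙≤1 (yes _) = ≤-refl
𝟙≤1 (no _)  = z≤n

sum-mono : ∀ {n} {f g : Fin n → ℕ} → (∀ i → f i ≤ g i) → sum f ≤ sum g
sum-mono {zero}  f≤g = z≤n
sum-mono {suc n} f≤g = +-mono-≤ (f≤g zero) (sum-mono (f≤g ∘ suc))

sum-mono-< : ∀ {n} {f g : Fin n → ℕ} → (∀ i → f i ≤ g i) → ∀ j → f j < g j → sum f < sum g
sum-mono-< {suc n} f≤g zero    fj<gj = +-mono-<-≤ fj<gj (sum-mono (f≤g ∘ suc))
sum-mono-< {suc n} f≤g (suc j) fj<gj = +-mono-≤-< (f≤g zero) (sum-mono-< (f≤g ∘ suc) j fj<gj)

sum-mono-≡ : ∀ {n} {f g : Fin n → ℕ} → (∀ i → f i ≤ g i) → sum f ≡ sum g → ∀ i → f i ≡ g i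
sum-mono-≡ f≤g Σf≡Σg i with m≤n⇒m<n∨m≡n (f≤g i)
... | inj₁ fi<gi = ⊥-elim (<-irrefl Σf≡Σg (sum-mono-< f≤g i fi<gi))
... | inj₂ fi≡gi = fi≡gi

sum-≤-* : ∀ {n b} {f : Fin n → ℕ} → (∀ i → f i ≤ b) → sum f ≤ n * b
sum-≤-* {zero}  f≤b = z≤n
sum-≤-* {suc n} f≤b = +-mono-≤ (f≤b zero) (sum-≤-* (f≤b ∘ suc))

sum-*2 : ∀ {n} (w : Fin n → ℕ) → sum (λ v → w v * 2) ≡ sum w + sum w
sum-*2 w = trans (sum-cong-≗ λ v → trans (*-comm (w v) 2) (cong (w v +_) (+-identityʳ (w v))))
                 (∑-distrib-+ w w)

term≤sum : ∀ {n} (f : Fin n → ℕ) i → f i ≤ sum f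
term≤sum f zero    = m≤m+n _ _
term≤sum f (suc i) = ≤-trans (term≤sum (f ∘ suc) i) (m≤n+m _ _)

sum-≤1 : ∀ {n} {f : Fin n → ℕ} → (∀ i → f i ≤ 1) → (∀ i j → 0 < f i → 0 < f j → i ≡ j) →
  sum f ≤ 1
sum-≤1 {zero}      f≤1 unique = z≤n
sum-≤1 {suc n} {f} f≤1 unique with f zero in f0
... | zero  = sum-≤1 (f≤1 ∘ suc) λ i j fi fj → Fin.suc-injective (unique (suc i) (suc j) fi fj)
... | suc _ = +-mono-≤ (subst (_≤ 1) f0 (f≤1 zero))
                       (subst (sum (f ∘ suc) ≤_) (*-zeroʳ n) (sum-≤-* tail≡0))
  where
  tail≡0 : ∀ i → f (suc i) ≤ 0
  tail≡0 i with f (suc i) in fi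
  ... | zero  = z≤n
  ... | suc _ with unique zero (suc i) (subst (0 <_) (sym f0) z<s) (subst (0 <_) (sym fi) z<s)
  ... | ()

𝟙*x≡𝟙⇒x≡1 : ∀ {a} {A : Set a} (d : Dec A) → A → ∀ {x} → 𝟙 d * x ≡ 𝟙 d → x ≡ 1
𝟙*x≡𝟙⇒x≡1 (yes _) _  {x} eq = trans (sym (+-identityʳ x)) eq
𝟙*x≡𝟙⇒x≡1 (no ¬a) a _ = ⊥-elim (¬a a)

sum≡size⇒≡1 : ∀ {n p} {P : Pred (Fin n) p} (P? : Decidable P) (g : Fin n → ℕ) →
  sum (λ i → 𝟙 (P? i) * g i) ≡ sum (𝟙 ∘ P?) →
  (∀ i → P i → g i ≤ 2) → (∀ i j → P i → P j → g i ≡ 2 → g j ≢ 0) →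
  ∀ i → P i → g i ≡ 1
sum≡size⇒≡1 P? g Σ≡ g≤2 no-2-0 i Pi with g i in gi
... | 1 = refl
... | 0 = trans (sym gi) (𝟙*x≡𝟙⇒x≡1 (P? i) Pi (sum-mono-≡ weighted≤ Σ≡ i))
  where
  weighted≤ : ∀ j → 𝟙 (P? j) * g j ≤ 𝟙 (P? j)
  weighted≤ j with P? j
  ... | no _   = z≤n
  ... | yes Pj = ≤-trans (≤-reflexive (+-identityʳ (g j)))
                   (s≤s⁻¹ (≤∧≢⇒< (g≤2 j Pj) λ gj≡2 → no-2-0 j i Pj Pi gj≡2 gi))
... | 2 = trans (sym gi) (𝟙*x≡𝟙⇒x≡1 (P? i) Pi (sym (sum-mono-≡ weighted≥ (sym Σ≡) i)))
  where
  weighted≥ : ∀ j → 𝟙 (P? j) ≤ 𝟙 (P? j) * g j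
  weighted≥ j with P? j
  ... | no _   = z≤n
  ... | yes Pj = ≤-trans (n≢0⇒n>0 (no-2-0 i j Pi Pj gi)) (≤-reflexive (sym (+-identityʳ (g j))))
... | suc (suc (suc _)) = ⊥-elim (<⇒≱ (subst (2 <_) (sym gi) (s≤s (s≤s z<s))) (g≤2 i Pi))

⨆ : ∀ {n} → (Fin n → ℕ) → ℕ
⨆ {zero}  f = 0
⨆ {suc n} f = f zero ⊔ ⨆ (f ∘ suc)

≤⨆ : ∀ {n} (f : Fin n → ℕ) i → f i ≤ ⨆ f
≤⨆ f zero    = m≤m⊔n _ _
≤⨆ f (suc i) = ≤-trans (≤⨆ (f ∘ suc) i) (m≤n⊔m _ _)

⨆< : ∀ {n b} (f : Fin n → ℕ) → 0 < b → (∀ i → f i < b) → ⨆ f < b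
⨆< {zero}  f 0<b f<b = 0<b
⨆< {suc n} f 0<b f<b = ⊔-lub (f<b zero) (⨆< (f ∘ suc) 0<b (f<b ∘ suc))

discrete-ivt : ∀ (u v : ℕ → ℕ) N → u 0 ≤ v 0 → v N ≤ u N →
  (∀ k → u (suc k) ≤ suc (u k)) → (∀ k → v k ≤ v (suc k)) → ∃[ k ] k ≤ N × u k ≡ v k
discrete-ivt u v zero    u0≤v0 v0≤u0 _ _ = 0 , z≤n , ≤-antisym u0≤v0 v0≤u0
discrete-ivt u v (suc N) u0≤v0 vN≤uN u-suc v-mono with u 0 ≟ v 0
... | yes u0≡v0 = 0 , z≤n , u0≡v0
... | no u0≢v0  with discrete-ivt (u ∘ suc) (v ∘ suc) N
                       (≤-trans (u-suc 0) (≤-trans (≤∧≢⇒< u0≤v0 u0≢v0) (v-mono 0))) vN≤uN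
                       (u-suc ∘ suc) (v-mono ∘ suc)
...   | k , k≤N , eq = suc k , s≤s k≤N , eq

-- The second component says a q ∸ a p ≤ (a q + b q) ∸ (a p + b p), without truncated subtraction.
+-mono-split : ∀ {a b : ℕ → ℕ} →
  (∀ {p q} → p ≤ q → a p ≤ a q) → (∀ {p q} → p ≤ q → b p ≤ b q) →
  ∀ {p q} → a p + b p ≤ a q + b q → a p ≤ a q × a q + (a p + b p) ≤ a p + (a q + b q)
+-mono-split {a} {b} a-mono b-mono {p} {q} σp≤σq with p ≤? q
... | yes p≤q = a-mono p≤q , (begin
  a q + (a p + b p)  ≡⟨ x∙yz≈y∙xz (a q) (a p) (b p) ⟩
  a p + (a q + b p)  ≤⟨ +-monoʳ-≤ (a p) (+-monoʳ-≤ (a q) (b-mono p≤q)) ⟩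
  a p + (a q + b q)  ∎)
  where open ≤-Reasoning
... | no p≰q = ap≤aq , +-mono-≤ (≤-reflexive aq≡ap) σp≤σq
  where
  q≤p : q ≤ p
  q≤p = <⇒≤ (≰⇒> p≰q)
  ap≤aq : a p ≤ a q
  ap≤aq = +-cancelʳ-≤ (b p) (a p) (a q) (≤-trans σp≤σq (+-monoʳ-≤ (a q) (b-mono q≤p)))
  aq≡ap : a q ≡ a p
  aq≡ap = ≤-antisym (a-mono q≤p) ap≤aq

+-squeezeˡ : ∀ {x y X Y} → x ≤ X → y ≤ Y → x + y ≡ X + Y → x ≡ X
+-squeezeˡ {x} {y} {X} {Y} x≤X y≤Y eq =
  ≤-antisym x≤X (+-cancelʳ-≤ Y X x (≤-trans (≤-reflexive (sym eq)) (+-monoʳ-≤ x y≤Y)))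

⊓-suc-≤ : ∀ k X → suc k ⊓ X ≤ suc (k ⊓ X)
⊓-suc-≤ k X = ⊓-monoʳ-≤ (suc k) (n≤1+n X)

Xor : Set → Set → Set
Xor A B = (A × ¬ B) ⊎ (¬ A × B)

Xor-comm : ∀ {A B} → Xor A B ⇔ Xor B A
Xor-comm = mk⇔ swap′ swap′
  where
  swap′ : ∀ {A B} → Xor A B → Xor B A
  swap′ (inj₁ (a , ¬b)) = inj₂ (¬b , a)
  swap′ (inj₂ (¬a , b)) = inj₁ (b , ¬a)

Xor-cong : ∀ {A B A′ B′} → A ⇔ A′ → B ⇔ B′ → Xor A B ⇔ Xor A′ B′
Xor-cong A⇔A′ B⇔B′ = mk⇔
  [ (λ (a , ¬b) → inj₁ (to A⇔A′ a , ¬b ∘ from B⇔B′))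
  , (λ (¬a , b) → inj₂ (¬a ∘ from A⇔A′ , to B⇔B′ b)) ]′
  [ (λ (a , ¬b) → inj₁ (from A⇔A′ a , ¬b ∘ to B⇔B′))
  , (λ (¬a , b) → inj₂ (¬a ∘ to A⇔A′ , from B⇔B′ b)) ]′

Xor-¬ : ∀ {A B} → Dec A → Dec B → Xor (¬ A) (¬ B) ⇔ Xor A B
Xor-¬ {A} {B} A? B? = mk⇔ to′ from′
  where
  to′ : Xor (¬ A) (¬ B) → Xor A B
  to′ (inj₁ (¬a , ¬¬b)) = inj₂ (¬a , decidable-stable B? ¬¬b)
  to′ (inj₂ (¬¬a , ¬b)) = inj₁ (decidable-stable A? ¬¬a , ¬b)
  from′ : Xor A B → Xor (¬ A) (¬ B)
  from′ (inj₁ (a , ¬b)) = inj₂ ((λ ¬a → ¬a a) , ¬b)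
  from′ (inj₂ (¬a , b)) = inj₁ (¬a , λ ¬b → ¬b b)

Xor-perm : ∀ (P : ℕ → Set) {x y} p → p ≡ (x , y) ⊎ p ≡ (y , x) →
  Xor (P x) (P y) ⇔ Xor (P (proj₁ p)) (P (proj₂ p))
Xor-perm P _ (inj₁ refl) = ⇔.refl
Xor-perm P _ (inj₂ refl) = Xor-comm

Xor<⇒separates : ∀ {x y s} → x < y → Xor (x < s) (y < s) → x < s × s ≤ y
Xor<⇒separates x<y (inj₁ (x<s , y≮s)) = x<s , ≮⇒≥ y≮s
Xor<⇒separates x<y (inj₂ (x≮s , y<s)) = ⊥-elim (x≮s (<-trans x<y y<s))

Btw : ℕ → ℕ → ℕ → Set
Btw a b z = a < z × z < b

btw? : ∀ a b z → Dec (Btw a b z)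
btw? a b z = (a <? z) ×-dec (z <? b)

Interleave⇔Xor : ∀ {a b c d} → c < d → c ≢ a → d ≢ b →
  Interleave _<_ a b c d ⇔ Xor (Btw a b c) (Btw a b d)
Interleave⇔Xor {a} {b} {c} {d} c<d c≢a d≢b = mk⇔ to′ from′
  where
  to′ : Interleave _<_ a b c d → Xor (Btw a b c) (Btw a b d)
  to′ (inj₁ (a<c , c<b , b<d)) = inj₁ ((a<c , c<b) , λ (_ , d<b) → <-asym d<b b<d)
  to′ (inj₂ (c<a , a<d , d<b)) = inj₂ ((λ (a<c , _) → <-asym a<c c<a) , (a<d , d<b))
  from′ : Xor (Btw a b c) (Btw a b d) → Interleave _<_ a b c d
  from′ (inj₁ ((a<c , c<b) , ¬d∈)) with <-cmp d b
  ... | tri< d<b _ _ = ⊥-elim (¬d∈ (<-trans a<c c<d , d<b))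
  ... | tri≈ _ d≡b _ = ⊥-elim (d≢b d≡b)
  ... | tri> _ _ b<d = inj₁ (a<c , c<b , b<d)
  from′ (inj₂ (¬c∈ , (a<d , d<b))) with <-cmp c a
  ... | tri< c<a _ _ = inj₂ (c<a , a<d , d<b)
  ... | tri≈ _ c≡a _ = ⊥-elim (c≢a c≡a)
  ... | tri> _ _ a<c = ⊥-elim (¬c∈ (a<c , <-trans c<d d<b))

Interleave-mono : ∀ {A : Set} {R S : A → A → Set} → (∀ {x y} → R x y → S x y) →
  ∀ {a b c d} → Interleave R a b c d → Interleave S a b c d
Interleave-mono R⇒S (inj₁ (p , q , r)) = inj₁ (R⇒S p , R⇒S q , R⇒S r)
Interleave-mono R⇒S (inj₂ (p , q , r)) = inj₂ (R⇒S p , R⇒S q , R⇒S r)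

lo hi : ∀ {n} {G : Graph n} → CircleModel G → Fin n → ℕ
lo CM v = CircleModel.endpt CM v 0F
hi CM v = CircleModel.endpt CM v 1F

Cross : ∀ {n} {G : Graph n} → CircleModel G → Fin n → Fin n → Set
Cross CM u v = Interleave _<_ (lo CM u) (hi CM u) (lo CM v) (hi CM v)

Clique : ∀ {n p} → Graph n → Pred (Fin n) p → Set p
Clique G P = ∀ u v → P u → P v → u ≢ v → Adj G u v

endpt-≢ : ∀ {n} {G : Graph n} (CM : CircleModel G) {u v} → u ≢ v →
  ∀ i j → CircleModel.endpt CM u i ≢ CircleModel.endpt CM v j
endpt-≢ CM u≢v i j eq = u≢v (proj₁ (CircleModel.distinct CM _ i _ j eq))

Cross⇒lo<hi : ∀ {n} {G : Graph n} (CM : CircleModel G) {u v} → Cross CM u v → lo CM u < hi CM v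
Cross⇒lo<hi CM (inj₁ (lou<lov , lov<hiu , hiu<hiv)) = <-trans lou<lov (<-trans lov<hiu hiu<hiv)
Cross⇒lo<hi CM (inj₂ (_ , lou<hiv , _)) = lou<hiv

-- Rotating a circle model

InWindow : ℕ → ℕ → ℕ → Set
InWindow t s z = t ≤ z × z < s

inWindow? : ∀ t s z → Dec (InWindow t s z)
inWindow? t s z = (t ≤? z) ×-dec (z <? s)

InWindow-convex : ∀ {t s a b z} → InWindow t s a → InWindow t s b → a < z → z < b → InWindow t s z
InWindow-convex (t≤a , _) (_ , b<s) a<z z<b = ≤-trans t≤a (<⇒≤ a<z) , <-trans z<b b<s

-- Reading the circle from t: positions before t are moved past M, which exceeds every end.
module Rotation (t M : ℕ) where

  shift : ℕ → ℕ
  shift z with z <? t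
  ... | yes _ = z + M
  ... | no _  = z

  shift-< : ∀ {z} → z < t → shift z ≡ z + M
  shift-< {z} z<t with z <? t
  ... | yes _   = refl
  ... | no z≮t = ⊥-elim (z≮t z<t)

  shift-≥ : ∀ {z} → t ≤ z → shift z ≡ z
  shift-≥ {z} t≤z with z <? t
  ... | yes z<t = ⊥-elim (<⇒≱ z<t t≤z)
  ... | no _    = refl

  shift-injective : ∀ {y z} → y < M → z < M → shift y ≡ shift z → y ≡ z
  shift-injective {y} {z} y<M z<M eq with y <? t | z <? t
  ... | yes _ | yes _ = +-cancelʳ-≡ M y z eq
  ... | yes _ | no _  = ⊥-elim (<⇒≱ z<M (subst (M ≤_) eq (m≤n+m M y)))
  ... | no _  | yes _ = ⊥-elim (<⇒≱ y<M (subst (M ≤_) (sym eq) (m≤n+m M z)))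
  ... | no _  | no _  = eq

  Straddles : ℕ → ℕ → Set
  Straddles a b = a < t × t ≤ b

  -- The chord (a, b) read from the new origin t: its ends change order exactly when it straddles t.
  rotated : ∀ a b → Dec (Straddles a b) → ℕ × ℕ
  rotated a b (yes _) = shift b , shift a
  rotated a b (no _)  = shift a , shift b

  rotate : ℕ → ℕ → ℕ × ℕ
  rotate a b = rotated a b ((a <? t) ×-dec (t ≤? b))

  rotate-perm : ∀ a b → rotate a b ≡ (shift a , shift b) ⊎ rotate a b ≡ (shift b , shift a)
  rotate-perm a b with (a <? t) ×-dec (t ≤? b)
  ... | yes _ = inj₂ refl
  ... | no _  = inj₁ refl

  rotate-ordered : ∀ {a b} → a < b → b < M → proj₁ (rotate a b) < proj₂ (rotate a b)
  rotate-ordered {a} {b} a<b b<M with (a <? t) ×-dec (t ≤? b)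
  ... | yes (a<t , t≤b) rewrite shift-< a<t | shift-≥ t≤b = <-≤-trans b<M (m≤n+m M a)
  ... | no ¬str with b <? t
  ...   | yes b<t rewrite shift-< (<-trans a<b b<t) = +-monoˡ-< M a<b
  ...   | no b≮t rewrite shift-≥ (≮⇒≥ λ a<t → ¬str (a<t , ≮⇒≥ b≮t)) = a<b

  Btw-shift : ∀ {a b z} → ¬ Straddles a b → a < b → b < M → z < M →
    Btw (shift a) (shift b) (shift z) ⇔ Btw a b z
  Btw-shift {a} {b} {z} ¬str a<b b<M z<M with b <? t | z <? t
  ... | yes b<t | yes z<t rewrite shift-< (<-trans a<b b<t) =
    mk⇔ (λ (p , q) → +-cancelʳ-< M a z p , +-cancelʳ-< M z b q)
        (λ (p , q) → +-monoˡ-< M p , +-monoˡ-< M q)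
  ... | yes b<t | no z≮t rewrite shift-< (<-trans a<b b<t) =
    mk⇔ (λ (p , _) → ⊥-elim (<-asym z<M (≤-<-trans (m≤n+m M a) p)))
        (λ (_ , q) → ⊥-elim (z≮t (<-trans q b<t)))
  ... | no b≮t | yes z<t rewrite shift-≥ (≮⇒≥ λ a<t → ¬str (a<t , ≮⇒≥ b≮t)) =
    mk⇔ (λ (_ , q) → ⊥-elim (<-asym b<M (≤-<-trans (m≤n+m M z) q)))
        (λ (p , _) → ⊥-elim (¬str (<-trans p z<t , ≮⇒≥ b≮t)))
  ... | no b≮t | no z≮t rewrite shift-≥ (≮⇒≥ λ a<t → ¬str (a<t , ≮⇒≥ b≮t)) =
    ⇔.refl

  Btw-shift-straddling : ∀ {a b z} → Straddles a b → b < M → z < M → z ≢ a → z ≢ b →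
    Btw (shift b) (shift a) (shift z) ⇔ (¬ Btw a b z)
  Btw-shift-straddling {a} {b} {z} (a<t , t≤b) b<M z<M z≢a z≢b with z <? t
  ... | yes z<t rewrite shift-< a<t | shift-≥ t≤b =
    mk⇔ (λ (_ , q) (p , _) → <-asym p (+-cancelʳ-< M z a q))
        (λ ¬btw → <-≤-trans b<M (m≤n+m M z)
                , +-monoˡ-< M (≤∧≢⇒< (≮⇒≥ λ a<z → ¬btw (a<z , <-≤-trans z<t t≤b)) z≢a))
  ... | no z≮t rewrite shift-< a<t | shift-≥ t≤b =
    mk⇔ (λ (p , _) (_ , q) → <-asym p q)
        (λ ¬btw → ≤∧≢⇒< (≮⇒≥ λ z<b → ¬btw (<-≤-trans a<t (≮⇒≥ z≮t) , z<b)) (z≢b ∘ sym)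
                , <-≤-trans z<M (m≤n+m M a))

  Xor-rotate : ∀ {a b c d} → a < b → b < M → c < M → d < M → c ≢ a → c ≢ b → d ≢ a → d ≢ b →
    let a′ , b′ = rotate a b
    in  Xor (Btw a′ b′ (shift c)) (Btw a′ b′ (shift d)) ⇔ Xor (Btw a b c) (Btw a b d)
  Xor-rotate {a} {b} {c} {d} a<b b<M c<M d<M c≢a c≢b d≢a d≢b with (a <? t) ×-dec (t ≤? b)
  ... | yes str = ⇔.trans (Xor-cong (Btw-shift-straddling str b<M c<M c≢a c≢b)
                                    (Btw-shift-straddling str b<M d<M d≢a d≢b))
                          (Xor-¬ (btw? a b c) (btw? a b d))
  ... | no ¬str = Xor-cong (Btw-shift ¬str a<b b<M c<M) (Btw-shift ¬str a<b b<M d<M)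

  rotate-∈ : ∀ a b → (proj₁ (rotate a b) ≡ shift a ⊎ proj₁ (rotate a b) ≡ shift b)
                   × (proj₂ (rotate a b) ≡ shift a ⊎ proj₂ (rotate a b) ≡ shift b)
  rotate-∈ a b with rotate-perm a b
  ... | inj₁ eq = inj₁ (cong proj₁ eq) , inj₂ (cong proj₂ eq)
  ... | inj₂ eq = inj₂ (cong proj₁ eq) , inj₁ (cong proj₂ eq)

  rotate-Interleave : ∀ {a b c d} → a < b → c < d → b < M → d < M →
    c ≢ a → c ≢ b → d ≢ a → d ≢ b →
    let a′ , b′ = rotate a b
        c′ , d′ = rotate c d
    in  Interleave _<_ a b c d ⇔ Interleave _<_ a′ b′ c′ d′
  rotate-Interleave {a} {b} {c} {d} a<b c<d b<M d<M c≢a c≢b d≢a d≢b = begin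
    Interleave _<_ a b c d
      ≈⟨ Interleave⇔Xor c<d c≢a d≢b ⟩
    Xor (Btw a b c) (Btw a b d)
      ≈⟨ ⇔.sym (Xor-rotate a<b b<M c<M d<M c≢a c≢b d≢a d≢b) ⟩
    Xor (Btw a′ b′ (shift c)) (Btw a′ b′ (shift d))
      ≈⟨ Xor-perm (Btw a′ b′) (rotate c d) (rotate-perm c d) ⟩
    Xor (Btw a′ b′ c′) (Btw a′ b′ d′)
      ≈⟨ ⇔.sym (Interleave⇔Xor (rotate-ordered c<d d<M) c′≢a′ d′≢b′) ⟩
    Interleave _<_ a′ b′ c′ d′
      ∎
    where
    open ⇔-Reasoning
    a′ b′ c′ d′ : ℕ
    a′ = proj₁ (rotate a b)
    b′ = proj₂ (rotate a b)
    c′ = proj₁ (rotate c d)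
    d′ = proj₂ (rotate c d)
    a<M : a < M
    a<M = <-trans a<b b<M
    c<M : c < M
    c<M = <-trans c<d d<M
    ≢′ : ∀ {x y} → x ≡ shift c ⊎ x ≡ shift d → y ≡ shift a ⊎ y ≡ shift b → x ≢ y
    ≢′ (inj₁ refl) (inj₁ refl) = c≢a ∘ shift-injective c<M a<M
    ≢′ (inj₁ refl) (inj₂ refl) = c≢b ∘ shift-injective c<M b<M
    ≢′ (inj₂ refl) (inj₁ refl) = d≢a ∘ shift-injective d<M a<M
    ≢′ (inj₂ refl) (inj₂ refl) = d≢b ∘ shift-injective d<M b<M
    c′≢a′ : c′ ≢ a′
    c′≢a′ = ≢′ (proj₁ (rotate-∈ c d)) (proj₁ (rotate-∈ a b))
    d′≢b′ : d′ ≢ b′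
    d′≢b′ = ≢′ (proj₂ (rotate-∈ c d)) (proj₂ (rotate-∈ a b))

  shift<⇔InWindow : ∀ {s z} → s ≤ M → z < M → shift z < s ⇔ InWindow t s z
  shift<⇔InWindow {s} {z} s≤M z<M with z <? t
  ... | yes z<t = mk⇔ (λ z+M<s → ⊥-elim (<⇒≱ z+M<s (≤-trans s≤M (m≤n+m M z))))
                      (λ (t≤z , _) → ⊥-elim (<⇒≱ z<t t≤z))
  ... | no z≮t  = mk⇔ (≮⇒≥ z≮t ,_) proj₂

module _ {n} {G : Graph n} (CM : CircleModel G) (t M : ℕ)
  (bounded : ∀ v i → CircleModel.endpt CM v i < M) where

  open Rotation t M
  open CircleModel CM

  private
    endpt′ : Fin n → Fin 2 → ℕ
    endpt′ v 0F = proj₁ (rotate (lo CM v) (hi CM v))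
    endpt′ v 1F = proj₂ (rotate (lo CM v) (hi CM v))

    ordered′ : ∀ v → endpt′ v 0F < endpt′ v 1F
    ordered′ v = rotate-ordered (ordered v) (bounded v 1F)

    endpt′-shift : ∀ v i → ∃[ j ] endpt′ v i ≡ shift (endpt v j)
    endpt′-shift v 0F = [ (0F ,_) , (1F ,_) ]′ (proj₁ (rotate-∈ (lo CM v) (hi CM v)))
    endpt′-shift v 1F = [ (0F ,_) , (1F ,_) ]′ (proj₂ (rotate-∈ (lo CM v) (hi CM v)))

    distinct′ : ∀ u i v j → endpt′ u i ≡ endpt′ v j → u ≡ v × i ≡ j
    distinct′ u i v j eq with endpt′-shift u i | endpt′-shift v j
    ... | i′ , eqᵢ | j′ , eqⱼ
      with distinct u i′ v j′ (shift-injective (bounded u i′) (bounded v j′)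
                                               (trans (sym eqᵢ) (trans eq eqⱼ)))
    ... | refl , _ = refl , same-chord i j eq
      where
      same-chord : ∀ i j → endpt′ u i ≡ endpt′ u j → i ≡ j
      same-chord 0F 0F _ = refl
      same-chord 1F 1F _ = refl
      same-chord 0F 1F e = ⊥-elim (<-irrefl e (ordered′ u))
      same-chord 1F 0F e = ⊥-elim (<-irrefl (sym e) (ordered′ u))

  rotateModel : CircleModel G
  rotateModel = record
    { endpt    = endpt′
    ; ordered  = ordered′
    ; distinct = distinct′
    ; adj⇔     = λ u v u≢v →
        let R = rotate-Interleave (ordered u) (ordered v) (bounded u 1F) (bounded v 1F)
                  (endpt-≢ CM (u≢v ∘ sym) 0F 0F) (endpt-≢ CM (u≢v ∘ sym) 0F 1F)
                  (endpt-≢ CM (u≢v ∘ sym) 1F 0F) (endpt-≢ CM (u≢v ∘ sym) 1F 1F)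
        in  to R ∘ proj₁ (adj⇔ u v u≢v) , proj₂ (adj⇔ u v u≢v) ∘ from R
    }

  rotateModel-separates : ∀ {s} → s ≤ M →
    ∀ v → Xor (InWindow t s (lo CM v)) (InWindow t s (hi CM v)) → lo rotateModel v < s × s ≤ hi rotateModel v
  rotateModel-separates s≤M v =
    Xor<⇒separates (ordered′ v)
    ∘ to (Xor-perm (_< _) (rotate (lo CM v) (hi CM v)) (rotate-perm (lo CM v) (hi CM v)))
    ∘ from (Xor-cong (shift<⇔InWindow s≤M (bounded v 0F)) (shift<⇔InWindow s≤M (bounded v 1F)))

-- Counting chord ends

𝟙+𝟙≡0 : ∀ {A B : Set} (a? : Dec A) (b? : Dec B) → 𝟙 a? + 𝟙 b? ≡ 0 → ¬ A × ¬ B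
𝟙+𝟙≡0 (no ¬a) (no ¬b) _  = ¬a , ¬b
𝟙+𝟙≡0 (no _)  (yes _) ()
𝟙+𝟙≡0 (yes _) _       ()

𝟙+𝟙≡1 : ∀ {A B : Set} (a? : Dec A) (b? : Dec B) → 𝟙 a? + 𝟙 b? ≡ 1 → Xor A B
𝟙+𝟙≡1 (yes a) (no ¬b) _ = inj₁ (a , ¬b)
𝟙+𝟙≡1 (no ¬a) (yes b) _ = inj₂ (¬a , b)
𝟙+𝟙≡1 (yes _) (yes _) ()
𝟙+𝟙≡1 (no _)  (no _)  ()

𝟙+𝟙≡2 : ∀ {A B : Set} (a? : Dec A) (b? : Dec B) → 𝟙 a? + 𝟙 b? ≡ 2 → A × B
𝟙+𝟙≡2 (yes a) (yes b) _  = a , b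
𝟙+𝟙≡2 (yes _) (no _)  ()
𝟙+𝟙≡2 (no _)  (yes _) ()
𝟙+𝟙≡2 (no _)  (no _)  ()

𝟙<-mono : ∀ {x p q} → p ≤ q → 𝟙 (x <? p) ≤ 𝟙 (x <? q)
𝟙<-mono {x} {p} {q} p≤q with x <? p | x <? q
... | yes x<p | no x≮q = ⊥-elim (x≮q (<-≤-trans x<p p≤q))
... | yes _   | yes _  = ≤-refl
... | no _    | _      = z≤n

𝟙≤-mono : ∀ {c x y} → x ≤ y → 𝟙 (c ≤? x) ≤ 𝟙 (c ≤? y)
𝟙≤-mono {c} {x} {y} x≤y with c ≤? x | c ≤? y
... | yes c≤x | no c≰y = ⊥-elim (c≰y (≤-trans c≤x x≤y))
... | yes _   | yes _  = ≤-refl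
... | no _    | _      = z≤n

𝟙<-suc : ∀ x p → 𝟙 (x <? suc p) ≤ 𝟙 (x <? p) + 𝟙 (x ≟ p)
𝟙<-suc x p with x <? suc p | x <? p | x ≟ p
... | no _     | _       | _       = z≤n
... | yes _    | yes _   | _       = s≤s z≤n
... | yes _    | no _    | yes _   = s≤s z≤n
... | yes x<1+p | no x≮p | no x≢p = ⊥-elim (x≢p (≤-antisym (s≤s⁻¹ x<1+p) (≮⇒≥ x≮p)))

𝟙<-split : ∀ {t s} x → t ≤ s → 𝟙 (x <? s) ≡ 𝟙 (x <? t) + 𝟙 (inWindow? t s x)
𝟙<-split {t} {s} x t≤s with x <? s | x <? t | t ≤? x
... | yes _   | yes _   | no _    = refl
... | yes _   | no _    | yes _   = refl
... | no _    | no _    | yes _   = refl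
... | no _    | no _    | no t≰x  = refl
... | _       | yes x<t | yes t≤x = ⊥-elim (<⇒≱ x<t t≤x)
... | yes _   | no x≮t  | no t≰x  = ⊥-elim (t≰x (≮⇒≥ x≮t))
... | no x≮s  | yes x<t | _       = ⊥-elim (x≮s (<-≤-trans x<t t≤s))

module Counting {n} {G : Graph n} (CM : CircleModel G) where

  open CircleModel CM

  below : Fin n → ℕ → ℕ
  below v p = 𝟙 (lo CM v <? p) + 𝟙 (hi CM v <? p)

  count : (Fin n → ℕ) → ℕ → ℕ
  count w p = sum λ v → w v * below v p

  inside : ℕ → ℕ → Fin n → ℕ
  inside t s v = 𝟙 (inWindow? t s (lo CM v)) + 𝟙 (inWindow? t s (hi CM v))

  below≤2 : ∀ v p → below v p ≤ 2
  below≤2 v p = +-mono-≤ (𝟙≤1 (lo CM v <? p)) (𝟙≤1 (hi CM v <? p))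

  count-mono : ∀ w {p q} → p ≤ q → count w p ≤ count w q
  count-mono w p≤q = sum-mono λ v → *-monoʳ-≤ (w v) (+-mono-≤ (𝟙<-mono p≤q) (𝟙<-mono p≤q))

  count-zero : ∀ w → count w 0 ≡ 0
  count-zero w =
    n≤0⇒n≡0 (subst (count w 0 ≤_) (*-zeroʳ n) (sum-≤-* λ v → ≤-reflexive (*-zeroʳ (w v))))

  count≤ : ∀ w p → count w p ≤ sum w + sum w
  count≤ w p = ≤-trans (sum-mono λ v → *-monoʳ-≤ (w v) (below≤2 v p)) (≤-reflexive (sum-*2 w))

  count-+ : ∀ w₁ w₂ p → count (λ v → w₁ v + w₂ v) p ≡ count w₁ p + count w₂ p
  count-+ w₁ w₂ p = trans (sum-cong-≗ λ v → *-distribʳ-+ (below v p) (w₁ v) (w₂ v))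
                          (∑-distrib-+ (λ v → w₁ v * below v p) (λ v → w₂ v * below v p))

  count-split : ∀ w {t s} → t ≤ s → count w s ≡ count w t + sum (λ v → w v * inside t s v)
  count-split w {t} {s} t≤s =
    trans (sum-cong-≗ split) (∑-distrib-+ (λ v → w v * below v t) (λ v → w v * inside t s v))
    where
    split : ∀ v → w v * below v s ≡ w v * below v t + w v * inside t s v
    split v = trans (cong (w v *_) (trans (cong₂ _+_ (𝟙<-split (lo CM v) t≤s) (𝟙<-split (hi CM v) t≤s))
                                          (interchange (𝟙 (lo CM v <? t)) _ _ _)))
                    (*-distribˡ-+ (w v) _ _)

  -- Consecutive positions differ by at most one chord end, as all ends are distinct.
  count-suc : ∀ w → (∀ v → w v ≤ 1) → ∀ p → count w (suc p) ≤ suc (count w p)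
  count-suc w w≤1 p = begin
    count w (suc p)                       ≤⟨ sum-mono step ⟩
    sum (λ v → w v * below v p + hits v)  ≡⟨ ∑-distrib-+ (λ v → w v * below v p) hits ⟩
    count w p + sum hits                  ≤⟨ +-monoʳ-≤ (count w p) (sum-≤1 hits≤1 hits-unique) ⟩
    count w p + 1                         ≡⟨ +-comm (count w p) 1 ⟩
    suc (count w p)                       ∎
    where
    open ≤-Reasoning
    hits : Fin n → ℕ
    hits v = 𝟙 (lo CM v ≟ p) + 𝟙 (hi CM v ≟ p)
    step : ∀ v → w v * below v (suc p) ≤ w v * below v p + hits v
    step v = begin
      w v * below v (suc p)
        ≤⟨ *-monoʳ-≤ (w v) (+-mono-≤ (𝟙<-suc (lo CM v) p) (𝟙<-suc (hi CM v) p)) ⟩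
      w v * ((𝟙 (lo CM v <? p) + 𝟙 (lo CM v ≟ p)) + (𝟙 (hi CM v <? p) + 𝟙 (hi CM v ≟ p)))
        ≡⟨ cong (w v *_) (interchange (𝟙 (lo CM v <? p)) _ _ _) ⟩
      w v * (below v p + hits v)
        ≡⟨ *-distribˡ-+ (w v) _ _ ⟩
      w v * below v p + w v * hits v
        ≤⟨ +-monoʳ-≤ (w v * below v p) (*-monoˡ-≤ (hits v) (w≤1 v)) ⟩
      w v * below v p + (hits v + 0)
        ≡⟨ cong (w v * below v p +_) (+-identityʳ (hits v)) ⟩
      w v * below v p + hits v
        ∎
    hits≤1 : ∀ v → hits v ≤ 1
    hits≤1 v with lo CM v ≟ p | hi CM v ≟ p
    ... | yes lo≡p | yes hi≡p = ⊥-elim (<-irrefl (trans lo≡p (sym hi≡p)) (ordered v))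
    ... | yes _    | no _     = ≤-refl
    ... | no _     | yes _    = ≤-refl
    ... | no _     | no _     = z≤n
    end-at-p : ∀ v → 0 < hits v → ∃[ i ] endpt v i ≡ p
    end-at-p v h with lo CM v ≟ p | hi CM v ≟ p
    ... | yes lo≡p | _       = 0F , lo≡p
    ... | no _     | yes hi≡p = 1F , hi≡p
    ... | no _     | no _    with () ← h
    hits-unique : ∀ u v → 0 < hits u → 0 < hits v → u ≡ v
    hits-unique u v hu hv with end-at-p u hu | end-at-p v hv
    ... | i , eᵢ | j , eⱼ = proj₁ (distinct u i v j (trans eᵢ (sym eⱼ)))

  B : ℕ
  B = suc (sum λ v → lo CM v + hi CM v)

  endpt<B : ∀ v i → endpt v i < B
  endpt<B v 0F = s≤s (≤-trans (m≤m+n (lo CM v) (hi CM v)) (term≤sum (λ v → lo CM v + hi CM v) v))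
  endpt<B v 1F = s≤s (≤-trans (m≤n+m (hi CM v) (lo CM v)) (term≤sum (λ v → lo CM v + hi CM v) v))

  count-B : ∀ w → count w B ≡ sum w + sum w
  count-B w = trans (sum-cong-≗ λ v → cong (w v *_) (below-B v)) (sum-*2 w)
    where
    𝟙<B : ∀ v i → 𝟙 (endpt v i <? B) ≡ 1
    𝟙<B v i with endpt v i <? B
    ... | yes _ = refl
    ... | no ≮B = ⊥-elim (≮B (endpt<B v i))
    below-B : ∀ v → below v B ≡ 2
    below-B v = cong₂ _+_ (𝟙<B v 0F) (𝟙<B v 1F)

  -- A chord with both ends in the window forces every chord crossing it to have an end there,
  -- so the values of inside t s on P avoid 0 or avoid 2, and then their total forces them all to be 1.
  clique-halved : ∀ {p} {P : Pred (Fin n) p} (P? : Decidable P) → Clique G P →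
    ∀ {t s} → t ≤ s → count (𝟙 ∘ P?) s ≡ count (𝟙 ∘ P?) t + sum (𝟙 ∘ P?) →
    ∀ v → P v → Xor (InWindow t s (lo CM v)) (InWindow t s (hi CM v))
  clique-halved {P = P} P? clique {t} {s} t≤s count-s v Pv =
    𝟙+𝟙≡1 (inWindow? t s (lo CM v)) (inWindow? t s (hi CM v))
      (sum≡size⇒≡1 P? (inside t s) Σinside (λ u _ → inside≤2 u) no-2-0 v Pv)
    where
    Σinside : sum (λ u → 𝟙 (P? u) * inside t s u) ≡ sum (𝟙 ∘ P?)
    Σinside = +-cancelˡ-≡ (count (𝟙 ∘ P?) t) _ _ (trans (sym (count-split (𝟙 ∘ P?) t≤s)) count-s)
    inside≤2 : ∀ u → inside t s u ≤ 2
    inside≤2 u = +-mono-≤ (𝟙≤1 (inWindow? t s (lo CM u))) (𝟙≤1 (inWindow? t s (hi CM u)))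
    no-2-0 : ∀ u v → P u → P v → inside t s u ≡ 2 → inside t s v ≢ 0
    no-2-0 u v Pu Pv in₂ in₀ with u ≟ᶠ v
    ... | yes refl = contradiction (trans (sym in₂) in₀) λ ()
    ... | no u≢v with 𝟙+𝟙≡2 (inWindow? t s (lo CM u)) (inWindow? t s (hi CM u)) in₂
                    | 𝟙+𝟙≡0 (inWindow? t s (lo CM v)) (inWindow? t s (hi CM v)) in₀
                    | proj₁ (adj⇔ u v u≢v) (clique u v Pu Pv u≢v)
    ...   | lou∈ , hiu∈ | lov∉ , _ | inj₁ (lou<lov , lov<hiu , _) =
      lov∉ (InWindow-convex lou∈ hiu∈ lou<lov lov<hiu)
    ...   | lou∈ , hiu∈ | _ , hiv∉ | inj₂ (_ , lou<hiv , hiv<hiu) =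
      hiv∉ (InWindow-convex lou∈ hiu∈ lou<hiv hiv<hiu)

  -- Parametrise positions by the number σ of ends of P ∪ Q to their left, and slide a window
  -- spanning half of these ends; the number of P-ends it contains changes by at most one per
  -- step and its values at the two extreme windows add up to |P| + |P|.
  module HalvingWindow {p q} {P : Pred (Fin n) p} {Q : Pred (Fin n) q}
    (P? : Decidable P) (Q? : Decidable Q) (disjoint : ∀ v → P v → ¬ Q v) where

    a b σ : ℕ → ℕ
    a = count (𝟙 ∘ P?)
    b = count (𝟙 ∘ Q?)
    σ x = a x + b x

    m l N : ℕ
    m = sum (𝟙 ∘ P?)
    l = sum (𝟙 ∘ Q?)
    N = m + l

    σ-suc : ∀ x → σ (suc x) ≤ suc (σ x)
    σ-suc x = subst₂ (λ y z → y ≤ suc z)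
                (count-+ (𝟙 ∘ P?) (𝟙 ∘ Q?) (suc x)) (count-+ (𝟙 ∘ P?) (𝟙 ∘ Q?) x)
                (count-suc (λ v → 𝟙 (P? v) + 𝟙 (Q? v)) 𝟙P+𝟙Q≤1 x)
      where
      𝟙P+𝟙Q≤1 : ∀ v → 𝟙 (P? v) + 𝟙 (Q? v) ≤ 1
      𝟙P+𝟙Q≤1 v with P? v | Q? v
      ... | yes Pv | yes Qv = ⊥-elim (disjoint v Pv Qv)
      ... | yes _  | no _   = ≤-refl
      ... | no _   | yes _  = ≤-refl
      ... | no _   | no _   = z≤n

    a-mono : ∀ {x y} → x ≤ y → a x ≤ a y
    a-mono = count-mono (𝟙 ∘ P?)

    b-mono : ∀ {x y} → x ≤ y → b x ≤ b y
    b-mono = count-mono (𝟙 ∘ Q?)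

    σ-mono : ∀ {x y} → x ≤ y → σ x ≤ σ y
    σ-mono x≤y = +-mono-≤ (a-mono x≤y) (b-mono x≤y)

    σ-zero : σ 0 ≡ 0
    σ-zero = cong₂ _+_ (count-zero (𝟙 ∘ P?)) (count-zero (𝟙 ∘ Q?))

    σ-B : σ B ≡ N + N
    σ-B = trans (cong₂ _+_ (count-B (𝟙 ∘ P?)) (count-B (𝟙 ∘ Q?))) (interchange m m l l)

    position : ∀ k → ∃[ x ] x ≤ B × σ x ≡ k ⊓ (N + N)
    position k = discrete-ivt σ (λ _ → k ⊓ (N + N)) B (≤-trans (≤-reflexive σ-zero) z≤n)
                   (≤-trans (m⊓n≤n k (N + N)) (≤-reflexive (sym σ-B))) σ-suc (λ _ → ≤-refl)

    -- Opaque, like halvingWindow below: only the specification is used, and unfolding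
    -- the search behind it makes type checking very slow.
    opaque
      T : ℕ → ℕ
      T k = proj₁ (position k)

      σ-T : ∀ k → σ (T k) ≡ k ⊓ (N + N)
      σ-T k = proj₂ (proj₂ (position k))

    σ-T-≤ : ∀ {k} → k ≤ N + N → σ (T k) ≡ k
    σ-T-≤ {k} k≤2N = trans (σ-T k) (m≤n⇒m⊓n≡m k≤2N)

    aT-split : ∀ k → a (T k) ≤ a (T (suc k)) × a (T (suc k)) + σ (T k) ≤ a (T k) + σ (T (suc k))
    aT-split k = +-mono-split {a} {b} a-mono b-mono {T k} {T (suc k)}
      (subst₂ _≤_ (sym (σ-T k)) (sym (σ-T (suc k))) (⊓-monoˡ-≤ (N + N) (n≤1+n k)))

    aT-mono : ∀ k → a (T k) ≤ a (T (suc k))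
    aT-mono k = proj₁ (aT-split k)

    aT-suc : ∀ k → a (T (suc k)) ≤ suc (a (T k))
    aT-suc k = +-cancelʳ-≤ (σ (T k)) _ _ (begin
      a (T (suc k)) + σ (T k)   ≤⟨ proj₂ (aT-split k) ⟩
      a (T k) + σ (T (suc k))   ≤⟨ +-monoʳ-≤ (a (T k)) σT-suc ⟩
      a (T k) + suc (σ (T k))   ≡⟨ +-suc (a (T k)) (σ (T k)) ⟩
      suc (a (T k)) + σ (T k)   ∎)
      where
      open ≤-Reasoning
      σT-suc : σ (T (suc k)) ≤ suc (σ (T k))
      σT-suc = subst₂ (λ x y → x ≤ suc y) (sym (σ-T (suc k))) (sym (σ-T k)) (⊓-suc-≤ k (N + N))

    aT-0 : a (T 0) ≡ 0
    aT-0 = n≤0⇒n≡0 (≤-trans (m≤m+n (a (T 0)) (b (T 0))) (≤-reflexive (σ-T 0)))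

    aT-2N : a (T (N + N)) ≡ m + m
    aT-2N = +-squeezeˡ (count≤ (𝟙 ∘ P?) (T (N + N))) (count≤ (𝟙 ∘ Q?) (T (N + N)))
              (trans (σ-T-≤ ≤-refl) (interchange m l m l))

    window : ∃[ k ] k ≤ N × a (T (k + N)) ≡ a (T k) + m
    window with ≤-total (a (T N)) m
    ... | inj₁ aTN≤m = discrete-ivt (λ k → a (T (k + N))) (λ k → a (T k) + m) N
          (subst (a (T N) ≤_) (cong (_+ m) (sym aT-0)) aTN≤m)
          (subst (a (T N) + m ≤_) (sym aT-2N) (+-monoˡ-≤ m aTN≤m))
          (λ k → aT-suc (k + N)) (λ k → +-monoˡ-≤ m (aT-mono k))
    ... | inj₂ m≤aTN with discrete-ivt (λ k → a (T k) + m) (λ k → a (T (k + N))) N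
          (subst (_≤ a (T N)) (cong (_+ m) (sym aT-0)) m≤aTN)
          (subst (_≤ a (T N) + m) (sym aT-2N) (+-monoˡ-≤ m m≤aTN))
          (λ k → +-monoˡ-≤ m (aT-suc k)) (λ k → aT-mono (k + N))
    ...   | k , k≤N , eq = k , k≤N , sym eq

    opaque
      halvingWindow : ∃₂ λ t s → t ≤ s × a s ≡ a t + m × b s ≡ b t + l
      halvingWindow with window
      ... | k , k≤N , a-eq = T k , T (k + N) , t≤s , a-eq , b-eq
        where
        σt : σ (T k) ≡ k
        σt = σ-T-≤ (≤-trans k≤N (m≤n+m N N))
        σs : σ (T (k + N)) ≡ k + N
        σs = σ-T-≤ (+-monoˡ-≤ N k≤N)
        t≤s : T k ≤ T (k + N)
        t≤s with T k ≤? T (k + N)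
        ... | yes t≤s = t≤s
        ... | no t≰s = ⊥-elim (<-irrefl (cong T k+N≡k) (≰⇒> t≰s))
          where
          k+N≡k : k + N ≡ k
          k+N≡k = ≤-antisym (subst₂ _≤_ σs σt (σ-mono (<⇒≤ (≰⇒> t≰s)))) (m≤m+n k N)
        b-eq : b (T (k + N)) ≡ b (T k) + l
        b-eq = +-cancelˡ-≡ (a (T k) + m) _ _ (begin
          (a (T k) + m) + b (T (k + N))  ≡⟨ cong (_+ b (T (k + N))) (sym a-eq) ⟩
          σ (T (k + N))                  ≡⟨ σs ⟩
          k + N                          ≡⟨ cong (_+ N) (sym σt) ⟩
          σ (T k) + (m + l)              ≡⟨ interchange (a (T k)) (b (T k)) m l ⟩
          (a (T k) + m) + (b (T k) + l)  ∎)
          where open ≡-Reasoning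

  two-cliques-window : ∀ {p q} {P : Pred (Fin n) p} {Q : Pred (Fin n) q}
    (P? : Decidable P) (Q? : Decidable Q) → Clique G P → Clique G Q → (∀ v → P v → ¬ Q v) →
    ∃₂ λ t s → t ≤ s × ∀ v → P v ⊎ Q v → Xor (InWindow t s (lo CM v)) (InWindow t s (hi CM v))
  two-cliques-window P? Q? P-clique Q-clique disjoint with HalvingWindow.halvingWindow P? Q? disjoint
  ... | t , s , t≤s , P-count , Q-count =
    t , s , t≤s , λ v → [ clique-halved P? P-clique t≤s P-count v
                        , clique-halved Q? Q-clique t≤s Q-count v ]′

two-cliques-separator : ∀ {n p q} {G : Graph n} (CM : CircleModel G)
  {P : Pred (Fin n) p} {Q : Pred (Fin n) q}
  (P? : Decidable P) (Q? : Decidable Q) → Clique G P → Clique G Q → (∀ v → P v → ¬ Q v) →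
  Σ[ CM′ ∈ CircleModel G ] ∃[ s ] ∀ v → P v ⊎ Q v → lo CM′ v < s × s ≤ hi CM′ v
two-cliques-separator CM P? Q? P-clique Q-clique disjoint
  with Counting.two-cliques-window CM P? Q? P-clique Q-clique disjoint
... | t , s , t≤s , halved =
  rotateModel CM t (s + B) endpt<s+B , s ,
  λ v → rotateModel-separates CM t (s + B) endpt<s+B (m≤m+n s B) v ∘ halved v
  where
  open Counting CM using (B; endpt<B)
  endpt<s+B : ∀ v i → CircleModel.endpt CM v i < s + B
  endpt<s+B v i = <-≤-trans (endpt<B v i) (m≤n+m B s)

clique-separator : ∀ {n p} {G : Graph n} (CM : CircleModel G) {P : Pred (Fin n) p} (P? : Decidable P) →
  Clique G P → ∃[ x ] ∀ v → P v → lo CM v < x × x ≤ hi CM v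
clique-separator {n} CM {P} P? clique =
  suc (⨆ lo-in-P) , λ v Pv → s≤s (≤-trans (lo≤ v Pv) (≤⨆ lo-in-P v)) , ⨆<hi v Pv
  where
  open CircleModel CM
  lo-in-P : Fin n → ℕ
  lo-in-P u = 𝟙 (P? u) * lo CM u
  lo≤ : ∀ v → P v → lo CM v ≤ lo-in-P v
  lo≤ v Pv with P? v
  ... | yes _  = ≤-reflexive (sym (+-identityʳ (lo CM v)))
  ... | no ¬Pv = ⊥-elim (¬Pv Pv)
  ⨆<hi : ∀ v → P v → ⨆ lo-in-P < hi CM v
  ⨆<hi v Pv = ⨆< lo-in-P (≤-<-trans z≤n (ordered v)) lo<hi
    where
    lo<hi : ∀ u → lo-in-P u < hi CM v
    lo<hi u with P? u | u ≟ᶠ v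
    ... | no _   | _        = ≤-<-trans z≤n (ordered v)
    ... | yes _  | yes refl = ≤-<-trans (≤-reflexive (+-identityʳ (lo CM v))) (ordered v)
    ... | yes Pu | no u≢v   = ≤-<-trans (≤-reflexive (+-identityʳ (lo CM u)))
                                (Cross⇒lo<hi CM (proj₁ (adj⇔ u v u≢v) (clique u v Pu Pv u≢v)))

-- Polygon models from cut points

≺⇒ : ∀ {k} {x y : BPt k} → x ≺ y → toℕ (proj₁ x) < toℕ (proj₁ y) ⊎ proj₂ x < proj₂ y
≺⇒ (side< s<t) = inj₁ s<t
≺⇒ (same< p<q) = inj₂ p<q

-- The side of a position x is the number of cut points th i ≤ x.
module _ {n} {G : Graph n} (CM : CircleModel G) {k} (th : Fin k → ℕ)
  (separated : ∀ v → ∃[ i ] lo CM v < th i × th i ≤ hi CM v) where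

  open CircleModel CM

  private
    cuts : ℕ → ℕ
    cuts x = sum λ i → 𝟙 (th i ≤? x)

    cuts<1+k : ∀ x → cuts x < suc k
    cuts<1+k x = s≤s (subst (cuts x ≤_) (*-identityʳ k) (sum-≤-* λ i → 𝟙≤1 (th i ≤? x)))

    cuts-mono : ∀ {x y} → x ≤ y → cuts x ≤ cuts y
    cuts-mono x≤y = sum-mono λ i → 𝟙≤-mono {th i} x≤y

    sideOf : ℕ → Fin (suc k)
    sideOf x = fromℕ< (cuts<1+k x)

    toℕ-sideOf : ∀ x → toℕ (sideOf x) ≡ cuts x
    toℕ-sideOf x = Fin.toℕ-fromℕ< (cuts<1+k x)

    point : ℕ → BPt (suc k)
    point x = sideOf x , x

    point-mono : ∀ {x y} → x < y → point x ≺ point y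
    point-mono {x} {y} x<y with m≤n⇒m<n∨m≡n (cuts-mono (<⇒≤ x<y))
    ... | inj₁ cx<cy = side< (subst₂ _<_ (sym (toℕ-sideOf x)) (sym (toℕ-sideOf y)) cx<cy)
    ... | inj₂ cx≡cy = subst (λ j → (sideOf x , x) ≺ (j , y))
                         (Fin.toℕ-injective (trans (toℕ-sideOf x) (trans cx≡cy (sym (toℕ-sideOf y)))))
                         (same< x<y)

    point-reflect : ∀ {x y} → point x ≺ point y → x < y
    point-reflect {x} {y} px≺py with ≺⇒ px≺py
    ... | inj₂ x<y = x<y
    ... | inj₁ sx<sy =
      ≰⇒> λ y≤x → <⇒≱ (subst₂ _<_ (toℕ-sideOf x) (toℕ-sideOf y) sx<sy) (cuts-mono y≤x)

    cuts-separated : ∀ v → cuts (lo CM v) < cuts (hi CM v)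
    cuts-separated v with separated v
    ... | i , lo<th , th≤hi = sum-mono-< (λ j → 𝟙≤-mono {th j} (<⇒≤ (ordered v))) i cut-at-i
      where
      cut-at-i : 𝟙 (th i ≤? lo CM v) < 𝟙 (th i ≤? hi CM v)
      cut-at-i with th i ≤? lo CM v | th i ≤? hi CM v
      ... | yes th≤lo | _        = ⊥-elim (<⇒≱ lo<th th≤lo)
      ... | no _      | yes _    = ≤-refl
      ... | no _      | no th≰hi = ⊥-elim (th≰hi th≤hi)

  separated⇒polygonModel : PolygonModel (suc k) G
  separated⇒polygonModel = record
    { endpt     = λ v i → point (endpt v i)
    ; ordered   = λ v → point-mono (ordered v)
    ; diffSides = λ v eq →
        <-irrefl (trans (sym (toℕ-sideOf (lo CM v))) (trans (cong toℕ eq) (toℕ-sideOf (hi CM v))))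
                 (cuts-separated v)
    ; distinct  = λ u i v j eq → distinct u i v j (cong proj₂ eq)
    ; adj⇔      = λ u v u≢v →
        Interleave-mono {S = λ x y → point x ≺ point y} point-mono ∘ proj₁ (adj⇔ u v u≢v) ,
        proj₂ (adj⇔ u v u≢v) ∘ Interleave-mono {R = λ x y → point x ≺ point y} point-reflect
    }

class-clique : ∀ {n c} {G : Graph n} (π : CliquePartition G c) i → Clique G (λ v → proj₁ π v ≡ i)
class-clique (f , same-class⇒adj) i u v fu≡i fv≡i = same-class⇒adj u v (trans fu≡i (sym fv≡i))

-- Classes 0 and 1 share the cut s, so 2 + k classes need only 1 + k cuts.
cliquePartition⇒polygonModel : ∀ {n k} {G : Graph n} → CircleModel G →
  CliquePartition G (suc (suc k)) → PolygonModel (suc (suc k)) G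
cliquePartition⇒polygonModel {k = k} {G} CM π@(f , _)
  with two-cliques-separator CM (λ v → f v ≟ᶠ 0F) (λ v → f v ≟ᶠ 1F)
         (class-clique {G = G} π 0F) (class-clique {G = G} π 1F)
         (λ v f≡0 f≡1 → Fin.0≢1+n (trans (sym f≡0) f≡1))
... | CM′ , s , separates = separated⇒polygonModel CM′ cut separated
  where
  separator : ∀ c → ∃[ x ] ∀ v → f v ≡ suc (suc c) → lo CM′ v < x × x ≤ hi CM′ v
  separator c = clique-separator CM′ (λ v → f v ≟ᶠ suc (suc c)) (class-clique {G = G} π (suc (suc c)))

  cut : Fin (suc k) → ℕ
  cut zero    = s
  cut (suc c) = proj₁ (separator c)

  separated : ∀ v → ∃[ i ] lo CM′ v < cut i × cut i ≤ hi CM′ v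
  separated v with f v in fv
  ... | 0F          = 0F , separates v (inj₁ fv)
  ... | 1F          = 0F , separates v (inj₂ fv)
  ... | suc (suc c) = suc c , proj₂ (separator c) v fv

partition≤1⇒IsClique : ∀ {n c} {G : Graph n} → c ≤ 1 → CliquePartition G c → IsClique G
partition≤1⇒IsClique {c = 0} _ (f , _) u = ⊥-elim (Fin.¬Fin0 (f u))
partition≤1⇒IsClique {c = 1} _ (f , same-class⇒adj) u v = same-class⇒adj u v (Fin1-unique (f u) (f v))
  where
  Fin1-unique : ∀ (i j : Fin 1) → i ≡ j
  Fin1-unique zero zero = refl
partition≤1⇒IsClique {c = suc (suc _)} (s≤s ())

corollary1 : ∀ {n : ℕ} (G : Graph n) → IsCircleGraph G → ¬ IsClique G →
    ∀ (p c : ℕ) → IsPolygonNumber G p → IsCliqueCoverNumber G c → p ≤ c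
corollary1 G CM ¬clique p 0 _ (partition , _) =
  ⊥-elim (¬clique (partition≤1⇒IsClique {G = G} z≤n partition))
corollary1 G CM ¬clique p 1 _ (partition , _) =
  ⊥-elim (¬clique (partition≤1⇒IsClique {G = G} ≤-refl partition))
corollary1 G CM _ p (suc (suc k)) (_ , _ , least) (partition , _) =
  least (suc (suc k)) (s≤s (s≤s z≤n)) (cliquePartition⇒polygonModel CM partition)
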